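{- For every pair of natural numbers $(k,n)$ and $r=k\lfloor\log n\rfloor$, the polytope $\mathrm{CUT}(K_r)$ is a projection (image under a linear map) of $\mathrm{STAB}_{k^2}(\mathrm{PLC}(k,n))$.
   Context: $\log$ is the binary logarithm; $m:=\lfloor\log n\rfloor$ and $[m]=\{1,\dots,m\}$. The paired local-cut graph $\mathrm{PLC}(k,n)$ has: cut vertices $(i,S)$ for $i\in[k]$, $S\subseteq[m]$; pairing vertices $(i,j,S,S')$ for $i\neq j\in[k]$, $S,S'\subseteq[m]$. Edges: for each $i$, all pairs of cut vertices $(i,S_1),(i,S_2)$ are adjacent; for each ordered pair $(i,j)$, all pairs of pairing vertices $(i,j,S_1,S_1'),(i,j,S_2,S_2')$ are adjacent; a cut vertex $(i,S)$ and a pairing vertex $(j_1,j_2,S_1,S_2)$ are adjacent if ($i=j_1$ and $S\neq S_1$) or ($i=j_2$ and $S\neq S_2$). No other edges. $\mathrm{STAB}_{k^2}(G)$ is the convex hull of the characteristic vectors in $\{0,1\}^{V(G)}$ of all independent sets of $G$ of size exactly $k^2$. For the complete graph $K_r$, for each $S\subseteq V(K_r)$ the cut vector $z\in\{0,1\}^{E(K_r)}$ has $z_e=1$ iff the edge $e$ has exactly one endpoint in $S$; $\mathrm{CUT}(K_r)$ is the convex hull of all such cut vectors.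
   Formalization: Both polytopes, $\mathrm{CUT}(K_r)$ and $\mathrm{STAB}_{k^2}(\mathrm{PLC}(k,n))$, are taken over ℚ: their points have rational coordinates, convex combinations use rational weights, and the linear map is ℚ-linear. -}

module Defs where

open import Data.Nat as ℕ using (ℕ)
open import Data.Nat.Logarithm using (⌊log₂_⌋)
open import Data.Bool using (Bool; true; false; if_then_else_; _xor_)
open import Data.Fin as Fin using (Fin)
open import Data.Fin.Subset using (Subset)
open import Data.Vec using (lookup)
open import Data.Rational using (ℚ; 0ℚ; 1ℚ; _+_; _*_; _≤_)
open import Data.List using (List; []; _∷_; length)
open import Data.List.Relation.Unary.All using (All)
open import Data.List.Relation.Unary.Unique.Propositional using (Unique)
open import Data.List.Membership.Propositional using (_∈_)
open import Data.Product using (Σ; Σ-syntax; ∃; ∃-syntax; _×_; _,_; proj₁)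
open import Data.Sum using (_⊎_)
open import Relation.Binary.PropositionalEquality using (_≡_; _≢_; _≗_)
open import Relation.Nullary using (¬_)

m : ℕ → ℕ
m n = ⌊log₂ n ⌋

-- The paired local-cut graph PLC(k,n), with M = ⌊log n⌋; subsets of [M]
-- are represented as Subset M (bit vectors of length M).

data PLCV (k M : ℕ) : Set where
  cutV  : Fin k → Subset M → PLCV k M
  pairV : (i j : Fin k) → .(i ≢ j) → Subset M → Subset M → PLCV k M

Adj : ∀ {k M} → PLCV k M → PLCV k M → Set
Adj (cutV i S₁) (cutV i' S₂) = i ≡ i' × S₁ ≢ S₂
Adj (pairV i j _ S₁ S₁') (pairV i' j' _ S₂ S₂') =
  i ≡ i' × j ≡ j' × ¬ (S₁ ≡ S₂ × S₁' ≡ S₂')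
Adj (cutV i S) (pairV j₁ j₂ _ S₁ S₂) = (i ≡ j₁ × S ≢ S₁) ⊎ (i ≡ j₂ × S ≢ S₂)
Adj (pairV j₁ j₂ _ S₁ S₂) (cutV i S) = (i ≡ j₁ × S ≢ S₁) ⊎ (i ≡ j₂ × S ≢ S₂)

Independent : {V : Set} → (V → V → Set) → (V → Bool) → Set
Independent {V} adj s = ∀ (u v : V) → s u ≡ true → s v ≡ true → ¬ adj u v

HasSize : {V : Set} → (V → Bool) → ℕ → Set
HasSize {V} s c = Σ[ L ∈ List V ] Unique L × length L ≡ c
                    × (∀ v → (s v ≡ true → v ∈ L) × (v ∈ L → s v ≡ true))

χ : {V : Set} → (V → Bool) → V → ℚ
χ s v = if s v then 1ℚ else 0ℚ

combo : {I V : Set} → (I → V → ℚ) → List (ℚ × I) → V → ℚ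
combo p [] v = 0ℚ
combo p ((w , i) ∷ L) v = w * p i v + combo p L v

wsum : {I : Set} → List (ℚ × I) → ℚ
wsum [] = 0ℚ
wsum ((w , _) ∷ L) = w + wsum L

InConv : {I V : Set} → (I → V → ℚ) → (V → ℚ) → Set
InConv {I} p x = Σ[ L ∈ List (ℚ × I) ]
  All (λ wi → 0ℚ ≤ proj₁ wi) L × wsum L ≡ 1ℚ × x ≗ combo p L

record IsLinear {V W : Set} (f : (V → ℚ) → (W → ℚ)) : Set where
  field
    ext      : ∀ {x y} → x ≗ y → f x ≗ f y
    additive : ∀ x y → f (λ v → x v + y v) ≗ (λ w → f x w + f y w)
    homog    : ∀ c x → f (λ v → c * x v) ≗ (λ w → c * f x w)

IndepOfSize : (k n : ℕ) → Set
IndepOfSize k n = Σ[ s ∈ (PLCV k (m n) → Bool) ]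
  Independent Adj s × HasSize s (k ℕ.* k)

stabPt : ∀ k n → IndepOfSize k n → PLCV k (m n) → ℚ
stabPt k n (s , _) = χ s

STAB : (k n : ℕ) → (PLCV k (m n) → ℚ) → Set
STAB k n = InConv (stabPt k n)

-- CUT(K_r): edges are unordered pairs {a,b}, represented with a < b

data Edge (r : ℕ) : Set where
  edge : (a b : Fin r) → .(a Fin.< b) → Edge r

cutPt : ∀ r → Subset r → Edge r → ℚ
cutPt r S (edge a b _) = if lookup S a xor lookup S b then 1ℚ else 0ℚ

CUT : (r : ℕ) → (Edge r → ℚ) → Set
CUT r = InConv (cutPt r)

-- An independent set of size k² meets each of the k² cliques of PLC(k,n) exactly once: the
-- cut vertices of block i, and the pairing vertices (i,j,·,·) for i ≠ j.  Non-adjacency to the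
-- chosen cut vertices (i, Bᵢ) forces the pairing vertices to be (i, j, Bᵢ, Bⱼ), so these sets
-- correspond exactly to subsets B₁ ∪ … ∪ Bₖ of [k·m], the vertex set of K_r.  The linear map
-- whose coordinate at an edge {(i,p),(j,q)} adds up the weights of the vertices of class (i,j)
-- whose subsets separate p from q sends the independent set of (Bᵢ) to the cut vector of ⋃ Bᵢ.
-- Hence it maps the vertices of STAB onto those of CUT, and so the hulls onto each other.
module Submission where

open import Defs
open import Algebra.Bundles using (CommutativeMonoid)
open import Data.Bool using (Bool; true; false; if_then_else_; _xor_; _∧_)
open import Data.Bool.Properties using (⇔→≡)
import Data.Bool.Properties as Bool
open import Data.Empty using (⊥-elim; ⊥-elim-irr)
open import Data.Fin as Fin using (Fin; remQuot; combine)
open import Data.Fin.Properties using (combine-remQuot)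
open import Data.Fin.Subset using (Subset)
open import Data.List using (List; []; _∷_; map; length; cartesianProduct; allFin)
open import Data.List.Properties using (length-map; length-++; length-tabulate; length-removeAt′)
open import Data.List.Relation.Unary.All as All using ([]; _∷_)
import Data.List.Relation.Unary.All.Properties as All
open import Data.List.Relation.Unary.AllPairs using ([]; _∷_)
open import Data.List.Relation.Unary.Any using (here; there; index; any?)
open import Data.List.Relation.Unary.Unique.Propositional using (Unique)
open import Data.List.Relation.Unary.Unique.Propositional.Properties
  using (map⁺; cartesianProduct⁺; allFin⁺)
open import Data.List.Membership.Propositional using (_∈_; _∉_; _─_)
open import Data.List.Membership.Propositional.Properties
  using (∈-map⁺; ∈-map⁻; ∈-cartesianProduct⁺; ∈-allFin)
open import Data.List.Relation.Binary.Subset.Propositional using (_⊆_)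
open import Data.Nat using (ℕ; zero; suc; _*_; _≤_; _<_; z≤n; s≤s) renaming (_+_ to _+ℕ_)
open import Data.Nat.Properties using (≤-reflexive; <⇒≱; n<1+n; module ≤-Reasoning)
open import Data.Product using (Σ-syntax; ∃-syntax; _×_; _,_; proj₁; proj₂; map₂)
import Data.Product.Properties as Product
open import Data.Rational using (ℚ; 0ℚ; 1ℚ; _+_) renaming (_*_ to _*ℚ_)
open import Data.Rational.Properties
  using (+-identityˡ; +-identityʳ; *-zeroˡ; *-zeroʳ; *-distribˡ-+; +-0-commutativeMonoid)
open import Data.Vec using ([]; _∷_; lookup; tabulate)
open import Data.Vec.Properties using (lookup∘tabulate; ∷-injectiveʳ; ≡-dec)
open import Data.Sum using (inj₁; inj₂)
open import Function using (_∘_; mk⇔)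
open import Relation.Binary.Definitions using (DecidableEquality)
open import Relation.Binary.PropositionalEquality
open import Relation.Nullary using (Dec; yes; no; does; _×-dec_)
open import Relation.Nullary.Decidable using (dec-true; dec-false; decidable-stable)
open import Algebra.Properties.CommutativeSemigroup
  (CommutativeMonoid.commutativeSemigroup +-0-commutativeMonoid) using (interchange)

does⇒ : ∀ {P : Set} (P? : Dec P) → does P? ≡ true → P
does⇒ (yes p) _ = p
does⇒ (no _) ()

_≟_ : ∀ {M} → DecidableEquality (Subset M)
_≟_ = ≡-dec Bool._≟_

infixr 8 ⟦_⟧·_
⟦_⟧·_ : Bool → ℚ → ℚ
⟦ b ⟧· q = if b then q else 0ℚ

⟦⟧·-zero : ∀ b → ⟦ b ⟧· 0ℚ ≡ 0ℚ
⟦⟧·-zero true  = refl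
⟦⟧·-zero false = refl

⟦⟧·-+ : ∀ b u v → ⟦ b ⟧· (u + v) ≡ ⟦ b ⟧· u + ⟦ b ⟧· v
⟦⟧·-+ true  u v = refl
⟦⟧·-+ false u v = sym (+-identityˡ 0ℚ)

⟦⟧·-* : ∀ b c u → ⟦ b ⟧· (c *ℚ u) ≡ c *ℚ ⟦ b ⟧· u
⟦⟧·-* true  c u = refl
⟦⟧·-* false c u = sym (*-zeroʳ c)

⟦⟧·-comm : ∀ a b q → ⟦ a ⟧· ⟦ b ⟧· q ≡ ⟦ b ⟧· ⟦ a ⟧· q
⟦⟧·-comm true  b q = refl
⟦⟧·-comm false b q = sym (⟦⟧·-zero b)

⟦⟧·-∧ : ∀ a b c q → ⟦ c ⟧· ⟦ a ∧ b ⟧· q ≡ ⟦ a ⟧· ⟦ b ⟧· ⟦ c ⟧· q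
⟦⟧·-∧ true  b c q = ⟦⟧·-comm c b q
⟦⟧·-∧ false b c q = ⟦⟧·-zero c

sumSubsets : ∀ M → (Subset M → ℚ) → ℚ
sumSubsets zero    h = h []
sumSubsets (suc M) h = sumSubsets M (h ∘ (true ∷_)) + sumSubsets M (h ∘ (false ∷_))

sumSubsets-cong : ∀ M {g h : Subset M → ℚ} → g ≗ h → sumSubsets M g ≡ sumSubsets M h
sumSubsets-cong zero    g≗h = g≗h []
sumSubsets-cong (suc M) g≗h =
  cong₂ _+_ (sumSubsets-cong M (g≗h ∘ (true ∷_))) (sumSubsets-cong M (g≗h ∘ (false ∷_)))

sumSubsets-+ : ∀ M (g h : Subset M → ℚ) →
               sumSubsets M (λ S → g S + h S) ≡ sumSubsets M g + sumSubsets M h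
sumSubsets-+ zero    g h = refl
sumSubsets-+ (suc M) g h =
  trans (cong₂ _+_ (sumSubsets-+ M g₁ h₁) (sumSubsets-+ M g₀ h₀))
        (interchange (sumSubsets M g₁) (sumSubsets M h₁) (sumSubsets M g₀) (sumSubsets M h₀))
  where
  g₁ g₀ h₁ h₀ : Subset M → ℚ
  g₁ = g ∘ (true ∷_)
  g₀ = g ∘ (false ∷_)
  h₁ = h ∘ (true ∷_)
  h₀ = h ∘ (false ∷_)

sumSubsets-* : ∀ M c (h : Subset M → ℚ) → sumSubsets M (λ S → c *ℚ h S) ≡ c *ℚ sumSubsets M h
sumSubsets-* zero    c h = refl
sumSubsets-* (suc M) c h =
  trans (cong₂ _+_ (sumSubsets-* M c _) (sumSubsets-* M c _)) (sym (*-distribˡ-+ c _ _))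

sumSubsets-zero : ∀ M {h : Subset M → ℚ} → (∀ S → h S ≡ 0ℚ) → sumSubsets M h ≡ 0ℚ
sumSubsets-zero zero    h≡0 = h≡0 []
sumSubsets-zero (suc M) h≡0 =
  trans (cong₂ _+_ (sumSubsets-zero M (h≡0 ∘ (true ∷_))) (sumSubsets-zero M (h≡0 ∘ (false ∷_))))
        (+-identityˡ 0ℚ)

sumSubsets-single : ∀ M {h : Subset M → ℚ} S₀ → (∀ S → S ≢ S₀ → h S ≡ 0ℚ) →
                    sumSubsets M h ≡ h S₀
sumSubsets-single zero    []          _   = refl
sumSubsets-single (suc M) (true ∷ S₀)  h≡0 =
  trans (cong₂ _+_ (sumSubsets-single M S₀ (λ S S≢S₀ → h≡0 _ (S≢S₀ ∘ ∷-injectiveʳ)))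
                   (sumSubsets-zero M (λ S → h≡0 _ λ ())))
        (+-identityʳ _)
sumSubsets-single (suc M) (false ∷ S₀) h≡0 =
  trans (cong₂ _+_ (sumSubsets-zero M (λ S → h≡0 _ λ ()))
                   (sumSubsets-single M S₀ (λ S S≢S₀ → h≡0 _ (S≢S₀ ∘ ∷-injectiveʳ))))
        (+-identityˡ _)

sumSubsets-⟦⟧· : ∀ M b (h : Subset M → ℚ) →
                 sumSubsets M (λ S → ⟦ b ⟧· h S) ≡ ⟦ b ⟧· sumSubsets M h
sumSubsets-⟦⟧· M true  h = refl
sumSubsets-⟦⟧· M false h = sumSubsets-zero M (λ _ → refl)

sumSubsets-indicator : ∀ M (S₀ : Subset M) (h : Subset M → ℚ) →
                       sumSubsets M (λ S → ⟦ does (S ≟ S₀) ⟧· h S) ≡ h S₀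
sumSubsets-indicator M S₀ h =
  trans (sumSubsets-single M S₀ (λ S S≢S₀ → cong (λ b → ⟦ b ⟧· h S) (dec-false (S ≟ S₀) S≢S₀)))
        (cong (λ b → ⟦ b ⟧· h S₀) (dec-true (S₀ ≟ S₀) refl))

module _ {V W : Set} {f : (V → ℚ) → (W → ℚ)} (f-linear : IsLinear f) where
  open IsLinear f-linear
  open ≡-Reasoning

  linear-zero : f (λ _ → 0ℚ) ≗ (λ _ → 0ℚ)
  linear-zero w = begin
    f (λ _ → 0ℚ) w        ≡⟨ ext (λ _ → sym (*-zeroˡ 0ℚ)) w ⟩
    f (λ _ → 0ℚ *ℚ 0ℚ) w  ≡⟨ homog 0ℚ (λ _ → 0ℚ) w ⟩
    0ℚ *ℚ f (λ _ → 0ℚ) w  ≡⟨ *-zeroˡ (f (λ _ → 0ℚ) w) ⟩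
    0ℚ                    ∎

  linear-combo : ∀ {I : Set} (p : I → V → ℚ) L → f (combo p L) ≗ combo (f ∘ p) L
  linear-combo p []            = linear-zero
  linear-combo p ((c , i) ∷ L) w = begin
    f (λ v → c *ℚ p i v + combo p L v) w      ≡⟨ additive (λ v → c *ℚ p i v) (combo p L) w ⟩
    f (λ v → c *ℚ p i v) w + f (combo p L) w  ≡⟨ cong₂ _+_ (homog c (p i) w) (linear-combo p L w) ⟩
    c *ℚ f (p i) w + combo (f ∘ p) L w        ∎

module _ {I J : Set} where

  reindex : (I → J) → List (ℚ × I) → List (ℚ × J)
  reindex φ = map (map₂ φ)

  wsum-reindex : ∀ φ L → wsum (reindex φ L) ≡ wsum L
  wsum-reindex φ []            = refl
  wsum-reindex φ ((c , _) ∷ L) = cong (c +_) (wsum-reindex φ L)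

  combo-reindex : ∀ {V} {p : I → V → ℚ} {q : J → V → ℚ} (φ : I → J) → (∀ i → q (φ i) ≗ p i) →
                  ∀ L → combo p L ≗ combo q (reindex φ L)
  combo-reindex φ q∘φ≗p []            v = refl
  combo-reindex φ q∘φ≗p ((c , i) ∷ L) v =
    cong₂ _+_ (cong (c *ℚ_) (sym (q∘φ≗p i v))) (combo-reindex φ q∘φ≗p L v)

  InConv-reindex : ∀ {V} {p : I → V → ℚ} {q : J → V → ℚ} (φ : I → J) → (∀ i → q (φ i) ≗ p i) →
                   ∀ {x} → InConv p x → InConv q x
  InConv-reindex φ q∘φ≗p (L , L≥0 , wsum≡1 , x≗) =
    reindex φ L , All.map⁺ L≥0 , trans (wsum-reindex φ L) wsum≡1 ,
    λ v → trans (x≗ v) (combo-reindex φ q∘φ≗p L v)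

module _ {I J V W : Set} {p : I → V → ℚ} {q : J → W → ℚ} {f : (V → ℚ) → (W → ℚ)}
         (f-linear : IsLinear f) where

  InConv-image : (ψ : I → J) → (∀ i → q (ψ i) ≗ f (p i)) →
                 ∀ {x y} → InConv p x → f x ≗ y → InConv q y
  InConv-image ψ q∘ψ≗f∘p {x} {y} (L , L≥0 , wsum≡1 , x≗) fx≗y =
    InConv-reindex ψ q∘ψ≗f∘p (L , L≥0 , wsum≡1 , y≗)
    where
    y≗ : y ≗ combo (f ∘ p) L
    y≗ w = trans (sym (fx≗y w))
                 (trans (IsLinear.ext f-linear x≗ w) (linear-combo f-linear p L w))

  InConv-preimage : (φ : J → I) → (∀ j → f (p (φ j)) ≗ q j) →
                    ∀ {y} → InConv q y → ∃[ x ] (InConv p x × f x ≗ y)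
  InConv-preimage φ f∘p∘φ≗q {y} (L , L≥0 , wsum≡1 , y≗) =
    combo p L′ , (L′ , All.map⁺ L≥0 , trans (wsum-reindex φ L) wsum≡1 , λ _ → refl) , fx≗y
    where
    L′ : List (ℚ × I)
    L′ = reindex φ L
    fx≗y : f (combo p L′) ≗ y
    fx≗y w = trans (linear-combo f-linear p L′ w)
                   (sym (trans (y≗ w) (combo-reindex φ f∘p∘φ≗q L w)))

module _ {A : Set} where
  open ≤-Reasoning

  ∈-─ : ∀ {x y} {ys : List A} (x∈ys : x ∈ ys) → y ∈ ys → x ≢ y → y ∈ ys ─ x∈ys
  ∈-─ (here refl) (here refl)  x≢y = ⊥-elim (x≢y refl)
  ∈-─ (here _)    (there y∈ys) _   = y∈ys
  ∈-─ (there _)   (here refl)  _   = here refl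
  ∈-─ (there x∈ys) (there y∈ys) x≢y = there (∈-─ x∈ys y∈ys x≢y)

  unique-⊆⇒length≤ : ∀ {xs ys : List A} → Unique xs → xs ⊆ ys → length xs ≤ length ys
  unique-⊆⇒length≤ [] _ = z≤n
  unique-⊆⇒length≤ {x ∷ xs} {ys} (x∉xs ∷ xs-unique) x∷xs⊆ys = begin
    suc (length xs)          ≤⟨ s≤s (unique-⊆⇒length≤ xs-unique xs⊆ys─x) ⟩
    suc (length (ys ─ x∈ys)) ≡⟨ length-removeAt′ ys (index x∈ys) ⟨
    length ys                ∎
    where
    x∈ys : x ∈ ys
    x∈ys = x∷xs⊆ys (here refl)
    xs⊆ys─x : xs ⊆ ys ─ x∈ys
    xs⊆ys─x y∈xs = ∈-─ x∈ys (x∷xs⊆ys (there y∈xs)) (All.lookup x∉xs y∈xs)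

  unique-⊆-∉⇒length< : ∀ {xs ys : List A} {y} → Unique xs → xs ⊆ ys → y ∈ ys → y ∉ xs →
                       length xs < length ys
  unique-⊆-∉⇒length< {xs} {ys} xs-unique xs⊆ys y∈ys y∉xs = begin-strict
    length xs                ≤⟨ unique-⊆⇒length≤ xs-unique xs⊆ys─y ⟩
    length (ys ─ y∈ys)       <⟨ n<1+n _ ⟩
    suc (length (ys ─ y∈ys)) ≡⟨ length-removeAt′ ys (index y∈ys) ⟨
    length ys                ∎
    where
    xs⊆ys─y : xs ⊆ ys ─ y∈ys
    xs⊆ys─y x∈xs = ∈-─ y∈ys (xs⊆ys x∈xs) (λ { refl → y∉xs x∈xs })

  unique-⊆-length≥⇒⊇ : DecidableEquality A → ∀ {xs ys : List A} → Unique xs → xs ⊆ ys →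
                       length ys ≤ length xs → ys ⊆ xs
  unique-⊆-length≥⇒⊇ _≟ᴬ_ {xs} xs-unique xs⊆ys ys≤xs {y} y∈ys with any? (y ≟ᴬ_) xs
  ... | yes y∈xs = y∈xs
  ... | no  y∉xs = ⊥-elim (<⇒≱ (unique-⊆-∉⇒length< xs-unique xs⊆ys y∈ys y∉xs) ys≤xs)

  unique-map⁺ : ∀ {B : Set} {f : A → B} {xs} →
                (∀ {x y} → x ∈ xs → y ∈ xs → x ≢ y → f x ≢ f y) → Unique xs → Unique (map f xs)
  unique-map⁺ f-inj [] = []
  unique-map⁺ f-inj (x∉xs ∷ xs-unique) =
    All.map⁺ (All.tabulate λ y∈xs → f-inj (here refl) (there y∈xs) (All.lookup x∉xs y∈xs)) ∷
    unique-map⁺ (λ x∈xs y∈xs → f-inj (there x∈xs) (there y∈xs)) xs-unique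

length-cartesianProduct : ∀ {A B : Set} (xs : List A) (ys : List B) →
                          length (cartesianProduct xs ys) ≡ length xs * length ys
length-cartesianProduct []       ys = refl
length-cartesianProduct (x ∷ xs) ys =
  trans (length-++ (map (x ,_) ys))
        (cong₂ _+ℕ_ (length-map (x ,_) ys) (length-cartesianProduct xs ys))

allPairs : ∀ k → List (Fin k × Fin k)
allPairs k = cartesianProduct (allFin k) (allFin k)

length-allPairs : ∀ k → length (allPairs k) ≡ k * k
length-allPairs k = trans (length-cartesianProduct (allFin k) (allFin k))
                          (cong₂ _*_ (length-tabulate {n = k} _) (length-tabulate {n = k} _))

∈-allPairs : ∀ {k} (c : Fin k × Fin k) → c ∈ allPairs k
∈-allPairs (i , j) = ∈-cartesianProduct⁺ (∈-allFin i) (∈-allFin j)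

allPairs-unique : ∀ k → Unique (allPairs k)
allPairs-unique k = cartesianProduct⁺ (allFin⁺ k) (allFin⁺ k)

module _ {k M : ℕ} where

  class : PLCV k M → Fin k × Fin k
  class (cutV i _)         = i , i
  class (pairV i j _ _ _)  = i , j

  same-class⇒adjacent : ∀ u v → class u ≡ class v → u ≢ v → Adj u v
  same-class⇒adjacent (cutV i S) (cutV .i S′) refl u≢v = refl , u≢v ∘ cong (cutV i)
  same-class⇒adjacent (pairV i j i≢j S T) (pairV .i .j _ S′ T′) refl u≢v =
    refl , refl , λ { (S≡S′ , T≡T′) → u≢v (cong₂ (pairV i j i≢j) S≡S′ T≡T′) }
  same-class⇒adjacent (cutV i _) (pairV .i .i i≢i _ _) refl _ = ⊥-elim-irr (i≢i refl)
  same-class⇒adjacent (pairV .i .i i≢i _ _) (cutV i _) refl _ = ⊥-elim-irr (i≢i refl)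

  every-class-occupied : ∀ {s} → Independent Adj s → HasSize s (k * k) →
                         ∀ c → ∃[ v ] (s v ≡ true × class v ≡ c)
  every-class-occupied {s} s-independent (L , L-unique , L-length , L-members) c =
    let v , v∈L , c≡class-v = ∈-map⁻ class (allPairs⊆classes (∈-allPairs c))
    in  v , selected v∈L , sym c≡class-v
    where
    selected : ∀ {v} → v ∈ L → s v ≡ true
    selected = proj₂ (L-members _)
    classes-unique : Unique (map class L)
    classes-unique = unique-map⁺
      (λ u∈L v∈L u≢v cu≡cv →
         s-independent _ _ (selected u∈L) (selected v∈L) (same-class⇒adjacent _ _ cu≡cv u≢v))
      L-unique
    allPairs⊆classes : allPairs k ⊆ map class L
    allPairs⊆classes = unique-⊆-length≥⇒⊇ (Product.≡-dec Fin._≟_ Fin._≟_) classes-unique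
      (λ {c} _ → ∈-allPairs c)
      (≤-reflexive (trans (length-allPairs k) (sym (trans (length-map class L) L-length))))

  Consistent : (Fin k → Subset M) → PLCV k M → Set
  Consistent B (cutV i S)          = S ≡ B i
  Consistent B (pairV i j _ S S′)  = S ≡ B i × S′ ≡ B j

  consistent? : ∀ B v → Dec (Consistent B v)
  consistent? B (cutV i S)          = S ≟ B i
  consistent? B (pairV i j _ S S′)  = S ≟ B i ×-dec S′ ≟ B j

  consistent : (Fin k → Subset M) → PLCV k M → Bool
  consistent B v = does (consistent? B v)

  module _ (B : Fin k → Subset M) where

    consistent-sound : ∀ v → consistent B v ≡ true → Consistent B v
    consistent-sound v = does⇒ (consistent? B v)

    consistent-complete : ∀ v → Consistent B v → consistent B v ≡ true
    consistent-complete v = dec-true (consistent? B v)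

    consistent-independent : Independent Adj (consistent B)
    consistent-independent u@(cutV i S) v@(cutV .i S′) u∈ v∈ (refl , S≢S′) =
      S≢S′ (trans (consistent-sound u u∈) (sym (consistent-sound v v∈)))
    consistent-independent u@(pairV i j _ S T) v@(pairV .i .j _ S′ T′) u∈ v∈ (refl , refl , ¬same) =
      let S≡ , T≡ = consistent-sound u u∈ ; S′≡ , T′≡ = consistent-sound v v∈
      in  ¬same (trans S≡ (sym S′≡) , trans T≡ (sym T′≡))
    consistent-independent u@(cutV i S) v@(pairV .i _ _ S₁ _) u∈ v∈ (inj₁ (refl , S≢S₁)) =
      S≢S₁ (trans (consistent-sound u u∈) (sym (proj₁ (consistent-sound v v∈))))
    consistent-independent u@(cutV i S) v@(pairV _ .i _ _ S₂) u∈ v∈ (inj₂ (refl , S≢S₂)) =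
      S≢S₂ (trans (consistent-sound u u∈) (sym (proj₂ (consistent-sound v v∈))))
    consistent-independent u@(pairV .i _ _ S₁ _) v@(cutV i S) u∈ v∈ (inj₁ (refl , S≢S₁)) =
      S≢S₁ (trans (consistent-sound v v∈) (sym (proj₁ (consistent-sound u u∈))))
    consistent-independent u@(pairV _ .i _ _ S₂) v@(cutV i S) u∈ v∈ (inj₂ (refl , S≢S₂)) =
      S≢S₂ (trans (consistent-sound v v∈) (sym (proj₂ (consistent-sound u u∈))))

    representative : Fin k × Fin k → PLCV k M
    representative (i , j) with i Fin.≟ j
    ... | yes _   = cutV i (B i)
    ... | no i≢j = pairV i j i≢j (B i) (B j)

    class-representative : ∀ c → class (representative c) ≡ c
    class-representative (i , j) with i Fin.≟ j
    ... | yes refl = refl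
    ... | no _     = refl

    consistent-representative : ∀ c → consistent B (representative c) ≡ true
    consistent-representative (i , j) with i Fin.≟ j
    ... | yes _ = consistent-complete (cutV i (B i)) refl
    ... | no i≢j = consistent-complete (pairV i j i≢j (B i) (B j)) (refl , refl)

    representative-class : ∀ v → consistent B v ≡ true → representative (class v) ≡ v
    representative-class v@(cutV i S) v∈ with i Fin.≟ i
    ... | yes _   = cong (cutV i) (sym (consistent-sound v v∈))
    ... | no i≢i = ⊥-elim (i≢i refl)
    representative-class v@(pairV i j i≢j S S′) v∈ with i Fin.≟ j
    ... | yes i≡j = ⊥-elim-irr (i≢j i≡j)
    ... | no _    = let S≡ , S′≡ = consistent-sound v v∈
                    in  cong₂ (pairV i j i≢j) (sym S≡) (sym S′≡)

    consistent-size : HasSize (consistent B) (k * k)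
    consistent-size =
      map representative (allPairs k) ,
      map⁺ (λ {c} {d} r≡r → trans (sym (class-representative c))
                              (trans (cong class r≡r) (class-representative d)))
           (allPairs-unique k) ,
      trans (length-map representative (allPairs k)) (length-allPairs k) ,
      λ v → (λ v∈ → subst (_∈ map representative (allPairs k)) (representative-class v v∈)
                          (∈-map⁺ representative (∈-allPairs (class v)))) ,
            (λ v∈L → let c , _ , v≡ = ∈-map⁻ representative v∈L
                     in  subst (λ w → consistent B w ≡ true) (sym v≡) (consistent-representative c))

  module _ {s : PLCV k M → Bool} (s-independent : Independent Adj s) (s-size : HasSize s (k * k))
    where

    cutOccupant : ∀ i → Σ[ S ∈ Subset M ] s (cutV i S) ≡ true
    cutOccupant i with every-class-occupied s-independent s-size (i , i)
    ... | cutV .i S , v∈ , refl            = S , v∈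
    ... | pairV .i .i i≢i _ _ , _ , refl   = ⊥-elim-irr (i≢i refl)

    pairOccupant : ∀ i j .(i≢j : i ≢ j) → Σ[ S ∈ Subset M ] Σ[ S′ ∈ Subset M ]
                   s (pairV i j i≢j S S′) ≡ true
    pairOccupant i j i≢j with every-class-occupied s-independent s-size (i , j)
    ... | cutV .i _ , _ , refl             = ⊥-elim-irr (i≢j refl)
    ... | pairV .i .j _ S S′ , v∈ , refl   = S , S′ , v∈

    chosenBlocks : Fin k → Subset M
    chosenBlocks i = proj₁ (cutOccupant i)

    selected⇒consistent : ∀ v → s v ≡ true → Consistent chosenBlocks v
    selected⇒consistent (cutV i S) v∈ =
      decidable-stable (S ≟ chosenBlocks i) λ S≢ →
        s-independent _ _ (proj₂ (cutOccupant i)) v∈ (refl , S≢ ∘ sym)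
    selected⇒consistent (pairV i j _ S S′) v∈ =
      decidable-stable (S ≟ chosenBlocks i) (λ S≢ →
        s-independent _ _ (proj₂ (cutOccupant i)) v∈ (inj₁ (refl , S≢ ∘ sym))) ,
      decidable-stable (S′ ≟ chosenBlocks j) (λ S′≢ →
        s-independent _ _ (proj₂ (cutOccupant j)) v∈ (inj₂ (refl , S′≢ ∘ sym)))

    consistent⇒selected : ∀ v → Consistent chosenBlocks v → s v ≡ true
    consistent⇒selected (cutV i _) refl = proj₂ (cutOccupant i)
    consistent⇒selected (pairV i j i≢j _ _) (refl , refl) =
      let T , T′ , v∈ = pairOccupant i j i≢j
          T≡ , T′≡ = selected⇒consistent (pairV i j i≢j T T′) v∈
      in  subst₂ (λ A A′ → s (pairV i j i≢j A A′) ≡ true) T≡ T′≡ v∈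

    selected≗consistent : s ≗ consistent chosenBlocks
    selected≗consistent v = ⇔→≡ (mk⇔
      (consistent-complete chosenBlocks v ∘ selected⇒consistent v)
      (consistent⇒selected v ∘ consistent-sound chosenBlocks v))

  block : Fin (k * M) → Fin k
  block a = proj₁ (remQuot {k} M a)

  offset : Fin (k * M) → Fin M
  offset a = proj₂ (remQuot {k} M a)

  blocksOf : Subset (k * M) → Fin k → Subset M
  blocksOf T i = tabulate (λ p → lookup T (combine i p))

  lookup-blocksOf : ∀ T a → lookup T a ≡ lookup (blocksOf T (block a)) (offset a)
  lookup-blocksOf T a =
    sym (trans (lookup∘tabulate _ (offset a)) (cong (lookup T) (combine-remQuot {k} M a)))

  assemble : (Fin k → Subset M) → Subset (k * M)
  assemble B = tabulate (λ a → lookup (B (block a)) (offset a))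

  separates : Fin M → Fin M → Subset M → Subset M → Bool
  separates p q S S′ = lookup S p xor lookup S′ q

  -- A vertex a of K_{k·M} is read as position (offset a) of block (block a); this is the
  -- coordinate at the edge {(i,p),(j,q)}.
  projectionEntry : (PLCV k M → ℚ) → (i j : Fin k) → Dec (i ≡ j) → Fin M → Fin M → ℚ
  projectionEntry x i _ (yes _)   p q = sumSubsets M λ S → ⟦ separates p q S S ⟧· x (cutV i S)
  projectionEntry x i j (no i≢j) p q =
    sumSubsets M λ S → sumSubsets M λ S′ → ⟦ separates p q S S′ ⟧· x (pairV i j i≢j S S′)

  projection : (PLCV k M → ℚ) → Edge (k * M) → ℚ
  projection x (edge a b _) =
    projectionEntry x (block a) (block b) (block a Fin.≟ block b) (offset a) (offset b)

  projectionEntry-cong : ∀ {x y} → x ≗ y → ∀ {i j} (i≟j : Dec (i ≡ j)) {p q} →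
                         projectionEntry x i j i≟j p q ≡ projectionEntry y i j i≟j p q
  projectionEntry-cong x≗y (yes _) {p} {q} =
    sumSubsets-cong M λ S → cong (⟦ separates p q S S ⟧·_) (x≗y _)
  projectionEntry-cong x≗y (no _) {p} {q} =
    sumSubsets-cong M λ S → sumSubsets-cong M λ S′ → cong (⟦ separates p q S S′ ⟧·_) (x≗y _)

  projectionEntry-+ : ∀ x y {i j} (i≟j : Dec (i ≡ j)) {p q} →
                      projectionEntry (λ v → x v + y v) i j i≟j p q
                        ≡ projectionEntry x i j i≟j p q + projectionEntry y i j i≟j p q
  projectionEntry-+ x y (yes _) {p} {q} =
    trans (sumSubsets-cong M λ S → ⟦⟧·-+ (separates p q S S) _ _) (sumSubsets-+ M _ _)
  projectionEntry-+ x y (no _) {p} {q} =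
    trans (sumSubsets-cong M λ S →
             trans (sumSubsets-cong M λ S′ → ⟦⟧·-+ (separates p q S S′) _ _) (sumSubsets-+ M _ _))
          (sumSubsets-+ M _ _)

  projectionEntry-* : ∀ c x {i j} (i≟j : Dec (i ≡ j)) {p q} →
                      projectionEntry (λ v → c *ℚ x v) i j i≟j p q
                        ≡ c *ℚ projectionEntry x i j i≟j p q
  projectionEntry-* c x (yes _) {p} {q} =
    trans (sumSubsets-cong M λ S → ⟦⟧·-* (separates p q S S) c _) (sumSubsets-* M c _)
  projectionEntry-* c x (no _) {p} {q} =
    trans (sumSubsets-cong M λ S →
             trans (sumSubsets-cong M λ S′ → ⟦⟧·-* (separates p q S S′) c _) (sumSubsets-* M c _))
          (sumSubsets-* M c _)

  projection-linear : IsLinear projection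
  projection-linear = record
    { ext      = λ { x≗y (edge a b _) → projectionEntry-cong x≗y (block a Fin.≟ block b) }
    ; additive = λ { x y (edge a b _) → projectionEntry-+ x y (block a Fin.≟ block b) }
    ; homog    = λ { c x (edge a b _) → projectionEntry-* c x (block a Fin.≟ block b) }
    }

  module _ (B : Fin k → Subset M) where
    open ≡-Reasoning

    projectionEntry-consistent : ∀ {i j} (i≟j : Dec (i ≡ j)) p q →
      projectionEntry (χ (consistent B)) i j i≟j p q ≡ ⟦ separates p q (B i) (B j) ⟧· 1ℚ
    projectionEntry-consistent {i} (yes refl) p q = begin
      sumSubsets M (λ S → ⟦ separates p q S S ⟧· ⟦ does (S ≟ B i) ⟧· 1ℚ)
        ≡⟨ sumSubsets-cong M (λ S → ⟦⟧·-comm (separates p q S S) _ 1ℚ) ⟩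
      sumSubsets M (λ S → ⟦ does (S ≟ B i) ⟧· ⟦ separates p q S S ⟧· 1ℚ)
        ≡⟨ sumSubsets-indicator M (B i) _ ⟩
      ⟦ separates p q (B i) (B i) ⟧· 1ℚ ∎
    projectionEntry-consistent {i} {j} (no _) p q = begin
      sumSubsets M (λ S → sumSubsets M λ S′ →
        ⟦ separates p q S S′ ⟧· ⟦ does (S ≟ B i) ∧ does (S′ ≟ B j) ⟧· 1ℚ)
        ≡⟨ sumSubsets-cong M (λ S → sumSubsets-cong M λ S′ →
             ⟦⟧·-∧ (does (S ≟ B i)) _ (separates p q S S′) 1ℚ) ⟩
      sumSubsets M (λ S → sumSubsets M λ S′ →
        ⟦ does (S ≟ B i) ⟧· ⟦ does (S′ ≟ B j) ⟧· ⟦ separates p q S S′ ⟧· 1ℚ)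
        ≡⟨ sumSubsets-cong M (λ S → sumSubsets-⟦⟧· M (does (S ≟ B i)) _) ⟩
      sumSubsets M (λ S → ⟦ does (S ≟ B i) ⟧· sumSubsets M λ S′ →
        ⟦ does (S′ ≟ B j) ⟧· ⟦ separates p q S S′ ⟧· 1ℚ)
        ≡⟨ sumSubsets-indicator M (B i) _ ⟩
      sumSubsets M (λ S′ → ⟦ does (S′ ≟ B j) ⟧· ⟦ separates p q (B i) S′ ⟧· 1ℚ)
        ≡⟨ sumSubsets-indicator M (B j) _ ⟩
      ⟦ separates p q (B i) (B j) ⟧· 1ℚ ∎

    projection-consistent : ∀ T → (∀ a → lookup T a ≡ lookup (B (block a)) (offset a)) →
                            projection (χ (consistent B)) ≗ cutPt (k * M) T
    projection-consistent T T≡B (edge a b _) rewrite T≡B a | T≡B b =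
      projectionEntry-consistent (block a Fin.≟ block b) (offset a) (offset b)

  independentSetOf : Subset (k * M) → Σ[ s ∈ (PLCV k M → Bool) ] Independent Adj s × HasSize s (k * k)
  independentSetOf T =
    consistent (blocksOf T) , consistent-independent (blocksOf T) , consistent-size (blocksOf T)

  projection-independentSetOf : ∀ T → projection (χ (proj₁ (independentSetOf T))) ≗ cutPt (k * M) T
  projection-independentSetOf T = projection-consistent (blocksOf T) T (lookup-blocksOf T)

  cutOf : Σ[ s ∈ (PLCV k M → Bool) ] Independent Adj s × HasSize s (k * k) → Subset (k * M)
  cutOf (_ , s-independent , s-size) = assemble (chosenBlocks s-independent s-size)

  cutPt-cutOf : ∀ I → cutPt (k * M) (cutOf I) ≗ projection (χ (proj₁ I))
  cutPt-cutOf (s , s-independent , s-size) e = begin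
    cutPt (k * M) (assemble B) e     ≡⟨ projection-consistent B (assemble B) (lookup∘tabulate _) e ⟨
    projection (χ (consistent B)) e  ≡⟨ IsLinear.ext projection-linear χs≗χB e ⟨
    projection (χ s) e               ∎
    where
    open ≡-Reasoning
    B : Fin k → Subset M
    B = chosenBlocks s-independent s-size
    χs≗χB : χ s ≗ χ (consistent B)
    χs≗χB v = cong (λ b → ⟦ b ⟧· 1ℚ) (selected≗consistent s-independent s-size v)

lemma11 : (k n : ℕ) →
    Σ[ f ∈ ((PLCV k (m n) → ℚ) → (Edge (k * m n) → ℚ)) ]
      IsLinear f ×
      (∀ (y : Edge (k * m n) → ℚ) →
        (CUT (k * m n) y → ∃[ x ] (STAB k n x × f x ≗ y)) ×
        (∃[ x ] (STAB k n x × f x ≗ y) → CUT (k * m n) y))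
lemma11 k n =
  projection , projection-linear ,
  λ y → InConv-preimage projection-linear independentSetOf projection-independentSetOf ,
        λ (x , x∈STAB , fx≗y) → InConv-image projection-linear cutOf cutPt-cutOf x∈STAB fx≗y
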